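{- Let $2<\alpha<\omega_1$, let $\mathcal F$ be an $\alpha$-uniform family on a final segment of $\mathbb N$, let $M\in\mathbb N^{[\infty]}$ and $0<\beta<\alpha$. If $t\in(\mathcal F\upharpoonright M)^{(\beta)}$, then either (i) $t/k\in\big((\mathcal F\upharpoonright M)_{\{k\}}\big)^{(\beta)}$, where $k=\min(t)$, or (ii) $t=t^{\mathcal F}_p$ for some $p\in\mathbb N$ with $p-1\in M$. Consequently $$(\mathcal F\upharpoonright M)^{(\beta)}\subseteq\bigcup_{k\in M}\big[(\mathcal F\upharpoonright M)_{\{k\}}\oplus\{\{k\}\}\big]^{(\beta)}\cup\{t^{\mathcal F}_p: t^{\mathcal F}_p\subseteq M\text{ and }p-1\in M\}.$$
   Context: Notation: $\mathbb N^{[\infty]}$ is the set of infinite subsets of $\mathbb N$; a final segment is $\{n,n+1,\dots\}$; $\max(\emptyset)=-1$; for $A\subseteq\mathbb N$ (finite or infinite) $A/k=\{n\in A:k<n\}$. For finite $s,t$: $s<_{lex}t$ iff $\min(s\triangle t)\in s$; $s\sqsubseteq t$ means $s=t\cap\{0,\dots,n\}$ for some $n$. For $\mathcal F\subseteq[\mathbb N]^{<\infty}$ and finite $u$: $\mathcal F_u=\{s: u\cup s\in\mathcal F,\ \max(u)<\min(s)\}$; $\mathcal F\upharpoonright M=\{s\in\mathcal F:s\subseteq M\}$. For families $\mathcal A,\mathcal B$: $\mathcal A\oplus\mathcal B=\{s\cup t: s\in\mathcal B,\ t\in\mathcal A,\ \max(s)<\min(t)\}$. Uniform families on an infinite $M\subseteq\mathbb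 N$: $\{\emptyset\}$ is the unique $0$-uniform family; $\mathcal F$ is $(\gamma+1)$-uniform on $M$ if $\mathcal F_{\{n\}}$ is $\gamma$-uniform on $M/n$ for all $n\in M$; for limit $\gamma$, $\mathcal F$ is $\gamma$-uniform on $M$ if there is an increasing sequence $(\gamma_k)_{k\in M}$ converging to $\gamma$ with $\mathcal F_{\{k\}}$ $\gamma_k$-uniform on $M/k$ for all $k\in M$. Uniform families are fronts (members pairwise $\sqsubseteq$-incomparable; every infinite subset has an initial segment in the family); for a uniform family $\mathcal G$ on a final segment $T$ and $n\in T$, $t^{\mathcal G}_n$ is the unique element of $\mathcal G$ with $t^{\mathcal G}_n\sqsubseteq\{n,n+1,\dots\}$. Topology: each uniform family on a final segment (in particular $\mathcal F$ and each $\mathcal F_{\{k\}}$, which is uniform on a final segment) carries the order topology of $<_{lex}$; subsets carry subspace topologies. Thus $(\mathcal F\upharpoonright M)^{(\beta)}$ and $[(\mathcal F\upharpoonright M)_{\{k\}}\oplus\{\{k\}\}]^{(\beta)}$ are computed in $\mathcal F$, and $((\mathcal F\upharpoonright M)_{\{k\}})^{(\beta)}$ in $\mathcal F_{\{k\}}$. CB derivatives: $A'$ is the set of points of $A$ that are limit points of $A$; $A^{(0)}=A$, $A^{(\gamma+1)}=(A^{(\gamma)})'$, intersections at limit stages. -}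

module Defs where

open import Level using (0ℓ)
open import Data.Nat using (ℕ; zero; suc; _<_; _≤_; _<?_)
open import Data.List using (List; []; _∷_; _++_; filter; length)
open import Data.List.Relation.Unary.All using (All)
open import Data.List.Relation.Unary.Linked using (Linked)
open import Data.Product using (Σ; ∃; _×_; _,_)
open import Data.Maybe using (Maybe; just; nothing)
open import Data.Unit using (⊤)
open import Relation.Binary.PropositionalEquality using (_≡_; _≢_)

-- Countable ordinals: Brouwer trees (every countable ordinal < ω₁ has
-- such a code).  Order as in Kraus–Nordvall Forsberg–Xu.

data Ord : Set where
  oz : Ord
  os : Ord → Ord
  ol : (ℕ → Ord) → Ord

data _≤ₒ_ : Ord → Ord → Set where
  ≤-zero     : ∀ {b} → oz ≤ₒ b
  ≤-trans    : ∀ {a b c} → a ≤ₒ b → b ≤ₒ c → a ≤ₒ c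
  ≤-suc      : ∀ {a b} → a ≤ₒ b → os a ≤ₒ os b
  ≤-cocone   : ∀ {a f} k → a ≤ₒ f k → a ≤ₒ ol f
  ≤-limiting : ∀ {f b} → (∀ k → f k ≤ₒ b) → ol f ≤ₒ b

_<ₒ_ : Ord → Ord → Set
a <ₒ b = os a ≤ₒ b

_≈ₒ_ : Ord → Ord → Set
a ≈ₒ b = (a ≤ₒ b) × (b ≤ₒ a)

-- Finite subsets of ℕ are strictly increasing lists; families of finite
-- sets are predicates on lists; subsets of ℕ are predicates on ℕ.

Family : Set₁
Family = List ℕ → Set

SubN : Set₁
SubN = ℕ → Set

Incr : List ℕ → Set
Incr = Linked _<_

Infinite : SubN → Set
Infinite M = ∀ n → ∃ λ m → n < m × M m

FinalSeg : ℕ → SubN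
FinalSeg n m = n ≤ m

_/ₛ_ : SubN → ℕ → SubN
(M /ₛ n) m = M m × n < m

_/ₗ_ : List ℕ → ℕ → List ℕ
t /ₗ k = filter (k <?_) t

_↾_ : Family → SubN → Family
(F ↾ M) s = F s × All M s

_₍_₎ : Family → ℕ → Family
(F ₍ k ₎) s = F (k ∷ s) × All (k <_) s

_⊕_ : Family → Family → Family
(A ⊕ B) u = ∃ λ s → ∃ λ t → B s × A t × All (λ x → All (x <_) t) s × u ≡ s ++ t

single : ℕ → Family
single k u = u ≡ k ∷ []

Members : SubN → Family → Set
Members M F = ∀ s → F s → Incr s × All M s × s ≢ []

data Uniform : Ord → SubN → Family → Set₁ where
  u-zero : ∀ {γ M F} → γ ≈ₒ oz → F [] → (∀ s → F s → s ≡ []) → Uniform γ M F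
  u-suc  : ∀ {γ δ M F} → γ ≈ₒ os δ → Members M F →
           (∀ n → M n → Uniform δ (M /ₛ n) (F ₍ n ₎)) → Uniform γ M F
  u-lim  : ∀ {γ M F} (g : ℕ → Ord) →
           (∀ {k k′} → M k → M k′ → k < k′ → g k <ₒ g k′) →
           (∀ {k} → M k → g k <ₒ γ) →
           (∀ δ → δ <ₒ γ → ∃ λ k → M k × δ ≤ₒ g k) →
           Members M F →
           (∀ k → M k → Uniform (g k) (M /ₛ k) (F ₍ k ₎)) → Uniform γ M F

-- Lexicographic order:  s <lex t  iff  min (s △ t) ∈ s  (on increasing lists)

data _<lex_ : List ℕ → List ℕ → Set where
  lex-end : ∀ {x s} → (x ∷ s) <lex []
  lex-lt  : ∀ {x y s t} → x < y → (x ∷ s) <lex (y ∷ t)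
  lex-eq  : ∀ {x s t} → s <lex t → (x ∷ s) <lex (x ∷ t)

-- Order topology of <lex on a space X, limit points, CB derivatives.
-- A basic neighbourhood of t is an interval (a,b) with a, b ∈ X ∪ {±∞}.

LowerOK : Family → Maybe (List ℕ) → List ℕ → Set
LowerOK X nothing  t = ⊤
LowerOK X (just a) t = X a × a <lex t

UpperOK : Family → Maybe (List ℕ) → List ℕ → Set
UpperOK X nothing  t = ⊤
UpperOK X (just b) t = X b × t <lex b

IsLimitPoint : Family → Family → List ℕ → Set
IsLimitPoint X A t = ∀ a b → LowerOK X a t → UpperOK X b t →
  ∃ λ s → A s × s ≢ t × LowerOK X a s × UpperOK X b s

Derived : Family → Family → Family
Derived X A t = A t × IsLimitPoint X A t

CB : Family → Family → Ord → Family
CB X A oz     = A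
CB X A (os γ) = Derived X (CB X A γ)
CB X A (ol f) = λ t → ∀ n → CB X A (f n) t

-- t = t^F_p :  t ∈ F and t ⊑ {p, p+1, ...}  (unique by the front property)

interval : ℕ → ℕ → List ℕ
interval p zero    = []
interval p (suc n) = p ∷ interval (suc p) n

IsTp : Family → ℕ → List ℕ → Set
IsTp F p t = F t × t ≡ interval p (length t)

module Submission where

-- Write A = F ↾ M and t = k ∷ r.  The CB derivatives of
-- A are local: if some open lex-interval (a , b) of F around t contains only
-- points of A with minimum k, then near t the space A looks like the copy
-- {k} ⊕ A₍k₎ of A₍k₎, so t ∈ A^(β) gives r ∈ (A₍k₎)^(β) (lemma
-- 'localise'), and conversely r ∈ (A₍k₎)^(β) gives k ∷ r ∈ ({k} ⊕ A₍k₎)^(β)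
-- (lemma 'lift').  Such an interval exists unless t = t^F_k with k-1 ∈ M:
--  * above t we take b = t^F_{k+1}; by the front property no member of F
--    with minimum > k lies lex-below it ('upperFence');
--  * below t we take nothing if k is the least point of the final segment,
--    a = t^F_k if t ≠ t^F_k (then t^F_k <lex t, again by the front property),
--    and a = t^F_{k-1} if t = t^F_k and k-1 ∉ M, because the points of A
--    with minimum k-1 are then excluded ('lowerFenceOrTp').  Excluded middle is used only to decide whether k-1 ∈ M.

open import Defs
open import Level using (0ℓ)
open import Axiom.ExcludedMiddle using (ExcludedMiddle)
open import Data.Nat using (ℕ; suc)
open import Data.List using (List; _∷_)
open import Data.List.Relation.Unary.All using (All)
open import Data.Product using (∃; _×_)
open import Data.Sum using (_⊎_)
open import Relation.Binary.PropositionalEquality using (_≡_)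

open import Data.Nat using (zero; _≤_; _<_; _<?_; _≤?_; _≟_; s≤s)
open import Data.Nat.Properties
  using (≤-antisym; <⇒≤; ≰⇒>; <-irrefl; <-cmp; m≤n⇒m<n∨m≡n; ≤-refl; <-trans; n<1+n)
  renaming (≤-trans to ≤ℕ-trans)
open import Data.List using ([]; _++_; length)
open import Data.List.Properties using (filter-all; filter-reject; ≡-dec)
open import Data.List.Relation.Unary.All using ([]; _∷_) renaming (map to All-map)
open import Data.List.Relation.Unary.Linked using ([]; [-]; _∷_)
open import Data.Product using (Σ; _,_; proj₁; proj₂)
open import Data.Sum using (inj₁; inj₂)
open import Data.Maybe using (Maybe; just; nothing)
open import Data.Unit using (⊤; tt)
open import Data.Empty using (⊥; ⊥-elim)
open import Relation.Nullary using (¬_; yes; no)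
open import Relation.Binary using (tri<; tri≈; tri>)
open import Relation.Binary.PropositionalEquality using (refl; sym; trans; cong; subst; _≢_)

-- Brouwer trees denoting the ordinal 0 (limits of zeros count as zero).
IsZero : Ord → Set
IsZero oz     = ⊤
IsZero (os _) = ⊥
IsZero (ol f) = ∀ k → IsZero (f k)

≤-zero-closed : ∀ {a b} → a ≤ₒ b → IsZero b → IsZero a
≤-zero-closed ≤-zero          _ = tt
≤-zero-closed (≤-trans p q)   z = ≤-zero-closed p (≤-zero-closed q z)
≤-zero-closed (≤-suc _)       ()
≤-zero-closed (≤-cocone k p)  z = ≤-zero-closed p (z k)
≤-zero-closed (≤-limiting h)  z = λ k → ≤-zero-closed (h k) z

positive≉zero : ∀ {γ} → oz <ₒ γ → ¬ (γ ≈ₒ oz)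
positive≉zero pos (γ≤0 , _) = ≤-zero-closed (≤-trans pos γ≤0) tt

incr-head< : ∀ {m r} → Incr (m ∷ r) → All (m <_) r
incr-head< [-]     = []
incr-head< (p ∷ l) = p ∷ All-map (<-trans p) (incr-head< l)

incr-tail : ∀ {m r} → Incr (m ∷ r) → Incr r
incr-tail [-]     = []
incr-tail (_ ∷ l) = l

incr-bounded : ∀ {k j r} → k ≤ j → Incr (j ∷ r) → All (k ≤_) (j ∷ r)
incr-bounded k≤j inc = k≤j ∷ All-map (λ p → ≤ℕ-trans k≤j (<⇒≤ p)) (incr-head< inc)

lex-head≤ : ∀ {j s k t} → (j ∷ s) <lex (k ∷ t) → j ≤ k
lex-head≤ (lex-lt p) = <⇒≤ p
lex-head≤ (lex-eq _) = ≤-refl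

lex-tail : ∀ {k s t} → (k ∷ s) <lex (k ∷ t) → s <lex t
lex-tail (lex-lt p) = ⊥-elim (<-irrefl refl p)
lex-tail (lex-eq p) = p

lex-trichotomy : ∀ s t → s ≡ t ⊎ s <lex t ⊎ t <lex s
lex-trichotomy []      []      = inj₁ refl
lex-trichotomy []      (_ ∷ _) = inj₂ (inj₂ lex-end)
lex-trichotomy (_ ∷ _) []      = inj₂ (inj₁ lex-end)
lex-trichotomy (x ∷ s) (y ∷ t) with <-cmp x y
... | tri< p _ _ = inj₂ (inj₁ (lex-lt p))
... | tri> _ _ p = inj₂ (inj₂ (lex-lt p))
... | tri≈ _ refl _ with lex-trichotomy s t
...   | inj₁ e         = inj₁ (cong (x ∷_) e)
...   | inj₂ (inj₁ p)  = inj₂ (inj₁ (lex-eq p))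
...   | inj₂ (inj₂ p)  = inj₂ (inj₂ (lex-eq p))

length-interval : ∀ m L → length (interval m L) ≡ L
length-interval m zero    = refl
length-interval m (suc L) = cong suc (length-interval (suc m) L)

below-interval⇒extends : ∀ L m s → Incr s → All (m ≤_) s → s <lex interval m L →
  ∃ λ x → ∃ λ w → s ≡ interval m L ++ (x ∷ w)
below-interval⇒extends zero    m (x ∷ w) _ _ lex-end = x , w , refl
below-interval⇒extends (suc L) m (j ∷ r) _ (m≤j ∷ _) (lex-lt j<m) =
  ⊥-elim (<-irrefl refl (≤ℕ-trans (s≤s m≤j) j<m))
below-interval⇒extends (suc L) m (.m ∷ r) inc _ (lex-eq p)
  with below-interval⇒extends L (suc m) r (incr-tail inc) (incr-head< inc) p
... | x , w , e = x , w , cong (m ∷_) e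

members : ∀ {γ M F} → Uniform γ M F → oz <ₒ γ → Members M F
members (u-zero γ≈0 _ _)        pos = ⊥-elim (positive≉zero pos γ≈0)
members (u-suc _ mem _)         _   = mem
members (u-lim _ _ _ _ mem _)   _   = mem

interval-member : ∀ {γ M F} → Uniform γ M F → ∀ m → (∀ x → m ≤ x → M x) →
  ∃ λ L → F (interval m L)
interval-member (u-zero _ F[] _) m _ = 0 , F[]
interval-member (u-suc _ _ sub) m seg
  with interval-member (sub m (seg m ≤-refl)) (suc m) (λ x p → seg x (<⇒≤ p) , p)
... | L , p = suc L , proj₁ p
interval-member (u-lim _ _ _ _ _ sub) m seg
  with interval-member (sub m (seg m ≤-refl)) (suc m) (λ x p → seg x (<⇒≤ p) , p)
... | L , p = suc L , proj₁ p

front : ∀ {γ M F} → Uniform γ M F → ∀ s x w → F s → ¬ F (s ++ (x ∷ w))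
front (u-zero _ _ only) s x w Fs Fsxw with only s Fs
... | refl with only _ Fsxw
... | ()
front (u-suc _ mem sub) [] _ _ F[] _ = proj₂ (proj₂ (mem [] F[])) refl
front (u-suc _ mem sub) (j ∷ s) x w Fs Fsxw with proj₁ (proj₂ (mem _ Fs))
... | Mj ∷ _ = front (sub j Mj) s x w (Fs , incr-head< (proj₁ (mem _ Fs)))
                                      (Fsxw , incr-head< (proj₁ (mem _ Fsxw)))
front (u-lim _ _ _ _ mem sub) [] _ _ F[] _ = proj₂ (proj₂ (mem [] F[])) refl
front (u-lim _ _ _ _ mem sub) (j ∷ s) x w Fs Fsxw with proj₁ (proj₂ (mem _ Fs))
... | Mj ∷ _ = front (sub j Mj) s x w (Fs , incr-head< (proj₁ (mem _ Fs)))
                                      (Fsxw , incr-head< (proj₁ (mem _ Fsxw)))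

CB⊆ : ∀ X A γ s → CB X A γ s → A s
CB⊆ X A oz     s h = h
CB⊆ X A (os γ) s h = CB⊆ X A γ s (proj₁ h)
CB⊆ X A (ol f) s h = CB⊆ X A (f 0) s (h 0)

filter-head : ∀ k r → All (k <_) r → (k ∷ r) /ₗ k ≡ r
filter-head k r k<r = trans (filter-reject (k <?_) (<-irrefl refl)) (filter-all (k <?_) k<r)

module Localisation (F A : Family) (A⊆F : ∀ s → A s → F s)
  (memb : ∀ s → F s → Incr s × s ≢ []) (k : ℕ) where

  LowerFence : List ℕ → Set
  LowerFence t = Σ (Maybe (List ℕ)) λ a → LowerOK F a t ×
    (∀ j s → A (j ∷ s) → LowerOK F a (j ∷ s) → k ≤ j)

  UpperFence : List ℕ → Set
  UpperFence t = Σ (Maybe (List ℕ)) λ b → UpperOK F b t ×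
    (∀ j s → A (j ∷ s) → UpperOK F b (j ∷ s) → j ≤ k)

  refine-lower : ∀ r → LowerFence (k ∷ r) → ∀ a' → LowerOK (F ₍ k ₎) a' r →
    Σ (LowerFence (k ∷ r)) λ fence →
      ∀ s → LowerOK F (proj₁ fence) (k ∷ s) → LowerOK (F ₍ k ₎) a' s
  refine-lower r fence nothing  _ = fence , λ _ _ → tt
  refine-lower r _ (just x) (Fkx , x<r) =
    (just (k ∷ x) , (proj₁ Fkx , lex-eq x<r) , λ _ _ _ lo → lex-head≤ (proj₂ lo)) ,
    λ s lo → Fkx , lex-tail (proj₂ lo)

  refine-upper : ∀ r → UpperFence (k ∷ r) → ∀ b' → UpperOK (F ₍ k ₎) b' r →
    Σ (UpperFence (k ∷ r)) λ fence →
      ∀ s → UpperOK F (proj₁ fence) (k ∷ s) → UpperOK (F ₍ k ₎) b' s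
  refine-upper r fence nothing  _ = fence , λ _ _ → tt
  refine-upper r _ (just y) (Fky , r<y) =
    (just (k ∷ y) , (proj₁ Fky , lex-eq r<y) , λ _ _ _ uo → lex-head≤ (proj₂ uo)) ,
    λ s uo → Fky , lex-tail (proj₂ uo)

  localise : ∀ γ r → CB F A γ (k ∷ r) → LowerFence (k ∷ r) → UpperFence (k ∷ r) →
    CB (F ₍ k ₎) (A ₍ k ₎) γ r
  localise oz r Akr _ _ = Akr , incr-head< (proj₁ (memb _ (A⊆F _ Akr)))
  localise (os γ) r (h , limit) lf uf = localise γ r h lf uf , isLimit
    where
    isLimit : IsLimitPoint (F ₍ k ₎) (CB (F ₍ k ₎) (A ₍ k ₎) γ) r
    isLimit a' b' la' ub' with refine-lower r lf a' la' | refine-upper r uf b' ub'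
    ... | lf′ , back-lower | uf′ , back-upper
      with limit (proj₁ lf′) (proj₁ uf′) (proj₁ (proj₂ lf′)) (proj₁ (proj₂ uf′))
    ...   | [] , c , _ = ⊥-elim (proj₂ (memb [] (A⊆F _ (CB⊆ F A γ [] c))) refl)
    ...   | j ∷ s , c , j∷s≢ , lo , uo
      with ≤-antisym (proj₂ (proj₂ uf′) j s (CB⊆ F A γ _ c) uo)
                     (proj₂ (proj₂ lf′) j s (CB⊆ F A γ _ c) lo)
    ...     | refl = s , localise γ s c (proj₁ lf′ , lo , proj₂ (proj₂ lf′))
                                        (proj₁ uf′ , uo , proj₂ (proj₂ uf′)) ,
                     (λ e → j∷s≢ (cong (k ∷_) e)) ,
                     back-lower s lo , back-upper s uo
  localise (ol f) r h lf uf = λ i → localise (f i) r (h i) lf uf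

  tail : List ℕ → List ℕ
  tail []      = []
  tail (_ ∷ s) = s

  project-lower : ∀ r a → LowerOK F a (k ∷ r) →
    Σ (Maybe (List ℕ)) λ a' → LowerOK (F ₍ k ₎) a' r ×
      (∀ s → LowerOK (F ₍ k ₎) a' s → LowerOK F a (k ∷ s))
  project-lower r nothing _ = nothing , tt , λ _ _ → tt
  project-lower r (just []) (_ , ())
  project-lower r (just (j ∷ y)) (Fy , lex-lt j<k) = nothing , tt , λ _ _ → Fy , lex-lt j<k
  project-lower r (just (.k ∷ y)) (Fy , lex-eq y<r) =
    just y , ((Fy , incr-head< (proj₁ (memb _ Fy))) , y<r) , λ s lo → Fy , lex-eq (proj₂ lo)

  project-upper : ∀ r b → UpperOK F b (k ∷ r) →
    Σ (Maybe (List ℕ)) λ b' → UpperOK (F ₍ k ₎) b' r ×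
      (∀ s → UpperOK (F ₍ k ₎) b' s → UpperOK F b (k ∷ s))
  project-upper r nothing _ = nothing , tt , λ _ _ → tt
  project-upper r (just []) (F[] , _) = nothing , tt , λ _ _ → F[] , lex-end
  project-upper r (just (j ∷ y)) (Fy , lex-lt k<j) = nothing , tt , λ _ _ → Fy , lex-lt k<j
  project-upper r (just (.k ∷ y)) (Fy , lex-eq r<y) =
    just y , ((Fy , incr-head< (proj₁ (memb _ Fy))) , r<y) , λ s uo → Fy , lex-eq (proj₂ uo)

  lift : ∀ γ r → CB (F ₍ k ₎) (A ₍ k ₎) γ r → CB F ((A ₍ k ₎) ⊕ single k) γ (k ∷ r)
  lift oz r h = (k ∷ []) , r , refl , h , (proj₂ h ∷ []) , refl
  lift (os γ) r (h , limit) = lift γ r h , isLimit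
    where
    isLimit : IsLimitPoint F (CB F ((A ₍ k ₎) ⊕ single k) γ) (k ∷ r)
    isLimit a b la ub with project-lower r a la | project-upper r b ub
    ... | a' , la' , back-lower | b' , ub' , back-upper with limit a' b' la' ub'
    ...   | s , c , s≢r , lo , uo =
            k ∷ s , lift γ s c , (λ e → s≢r (cong tail e)) , back-lower s lo , back-upper s uo
  lift (ol f) r h = λ i → lift (f i) r (h i)

module Derivatives (em : ExcludedMiddle 0ℓ) (α : Ord) (pos : oz <ₒ α) (F : Family)
  (n : ℕ) (U : Uniform α (FinalSeg n) F) (M : SubN) where

  A : Family
  A = F ↾ M

  memb : ∀ s → F s → Incr s × s ≢ []
  memb s Fs = proj₁ (members U pos s Fs) , proj₂ (proj₂ (members U pos s Fs))

  open module L (k : ℕ) = Localisation F A (λ _ → proj₁) memb k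

  head≥n : ∀ {j s} → F (j ∷ s) → n ≤ j
  head≥n Fjs with proj₁ (proj₂ (members U pos _ Fjs))
  ... | n≤j ∷ _ = n≤j

  tp : ∀ m → n ≤ m → ∃ λ L → F (interval m (suc L))
  tp m n≤m with interval-member U m (λ x p → ≤ℕ-trans n≤m p)
  ... | zero  , F[] = ⊥-elim (proj₂ (memb [] F[]) refl)
  ... | suc L , Fi  = L , Fi

  not-below-tp : ∀ m L s → F (interval m L) → F s → All (m ≤_) s → ¬ (s <lex interval m L)
  not-below-tp m L s Fi Fs m≤s s<i with below-interval⇒extends L m s (proj₁ (memb s Fs)) m≤s s<i
  ... | x , w , e = front U (interval m L) x w Fi (subst F e Fs)

  upperFence : ∀ k r → A (k ∷ r) → UpperFence k (k ∷ r)
  upperFence k r (Fkr , _) =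
    just (interval (suc k) (suc L)) , (Fi , lex-lt (n<1+n k)) , heads≤k
    where
    L : ℕ
    L = proj₁ (tp (suc k) (≤ℕ-trans (head≥n Fkr) (<⇒≤ (n<1+n k))))
    Fi : F (interval (suc k) (suc L))
    Fi = proj₂ (tp (suc k) (≤ℕ-trans (head≥n Fkr) (<⇒≤ (n<1+n k))))
    heads≤k : ∀ j s → A (j ∷ s) → UpperOK F (just (interval (suc k) (suc L))) (j ∷ s) → j ≤ k
    heads≤k j s (Fjs , _) (_ , js<i) with j ≤? k
    ... | yes j≤k = j≤k
    ... | no  j≰k = ⊥-elim (not-below-tp (suc k) (suc L) (j ∷ s) Fi Fjs
                             (incr-bounded (≰⇒> j≰k) (proj₁ (memb _ Fjs))) js<i)

  tp-below : ∀ k r L → F (k ∷ r) → F (interval k (suc L)) →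
    k ∷ r ≢ interval k (length (k ∷ r)) → interval k (suc L) <lex (k ∷ r)
  tp-below k r L Fkr Fi k∷r≢tp with lex-trichotomy (k ∷ r) (interval k (suc L))
  ... | inj₂ (inj₂ i<t) = i<t
  ... | inj₂ (inj₁ t<i) =
    ⊥-elim (not-below-tp k (suc L) (k ∷ r) Fi Fkr (incr-bounded ≤-refl (proj₁ (memb _ Fkr))) t<i)
  ... | inj₁ t≡i = ⊥-elim (k∷r≢tp (trans t≡i (cong (interval k) length≡)))
    where
    length≡ : suc L ≡ length (k ∷ r)
    length≡ = trans (sym (length-interval k (suc L))) (cong length (sym t≡i))

  lowerFenceOrTp : ∀ k r → A (k ∷ r) →
    LowerFence k (k ∷ r) ⊎ (∃ λ p → IsTp F p (k ∷ r) × ∃ λ q → p ≡ suc q × M q)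
  lowerFenceOrTp k r (Fkr , _) with m≤n⇒m<n∨m≡n (head≥n Fkr)
  ... | inj₂ refl = inj₁ (nothing , tt , λ j s Ajs _ → head≥n (proj₁ Ajs))
  ... | inj₁ (s≤s {_} {q} n≤q) with ≡-dec _≟_ (k ∷ r) (interval k (length (k ∷ r)))
  ...   | no k∷r≢tp = inj₁ (just (interval k (suc L)) ,
                           (Fi , tp-below k r L Fkr Fi k∷r≢tp) , λ _ _ _ lo → lex-head≤ (proj₂ lo))
    where
    L : ℕ
    L = proj₁ (tp k (head≥n Fkr))
    Fi : F (interval k (suc L))
    Fi = proj₂ (tp k (head≥n Fkr))
  ...   | yes k∷r≡tp with em {M q}
  ...     | yes Mq = inj₂ (suc q , (Fkr , k∷r≡tp) , q , refl , Mq)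
  ...     | no ¬Mq = inj₁ (just (interval q (suc L)) , (Fi , lex-lt (n<1+n q)) , heads≥k)
    where
    L : ℕ
    L = proj₁ (tp q n≤q)
    Fi : F (interval q (suc L))
    Fi = proj₂ (tp q n≤q)
    -- points of A with minimum q are excluded since q ∉ M
    heads≥k : ∀ j s → A (j ∷ s) → LowerOK F (just (interval q (suc L))) (j ∷ s) → suc q ≤ j
    heads≥k j s (_ , Mj ∷ _) (_ , i<js) with m≤n⇒m<n∨m≡n (lex-head≤ i<js)
    ... | inj₁ q<j = q<j
    ... | inj₂ refl = ⊥-elim (¬Mq Mj)

  split : ∀ β t → CB F A β t →
    (∃ λ k → ∃ λ r → t ≡ k ∷ r × CB (F ₍ k ₎) (A ₍ k ₎) β (t /ₗ k))
    ⊎ (∃ λ p → IsTp F p t × ∃ λ q → p ≡ suc q × M q)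
  split β [] cb = ⊥-elim (proj₂ (memb [] (proj₁ (CB⊆ F A β [] cb))) refl)
  split β (k ∷ r) cb with lowerFenceOrTp k r (CB⊆ F A β _ cb)
  ... | inj₂ isTp = inj₂ isTp
  ... | inj₁ lf = inj₁ (k , r , refl ,
    subst (CB (F ₍ k ₎) (A ₍ k ₎) β) (sym (filter-head k r k<r))
          (localise k β r cb lf (upperFence k r (CB⊆ F A β _ cb))))
    where
    k<r : All (k <_) r
    k<r = incr-head< (proj₁ (memb _ (proj₁ (CB⊆ F A β _ cb))))

  cover : ∀ β t → CB F A β t →
    (∃ λ k → M k × CB F ((A ₍ k ₎) ⊕ single k) β t)
    ⊎ (∃ λ p → IsTp F p t × All M t × ∃ λ q → p ≡ suc q × M q)
  cover β t cb with split β t cb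
  ... | inj₂ (p , isTp , rest) = inj₂ (p , isTp , proj₂ (CB⊆ F A β t cb) , rest)
  ... | inj₁ (k , r , refl , c) with CB⊆ F A β _ cb
  ...   | Fkr , Mk ∷ _ = inj₁ (k , Mk , lift k β r
          (subst (CB (F ₍ k ₎) (A ₍ k ₎) β) (filter-head k r (incr-head< (proj₁ (memb _ Fkr)))) c))

mainTheorem7 : ExcludedMiddle 0ℓ →
    (α : Ord) → os (os oz) <ₒ α →
    (F : Family) → (∃ λ n → Uniform α (FinalSeg n) F) →
    (M : SubN) → Infinite M →
    (β : Ord) → oz <ₒ β → β <ₒ α →
    ((t : List ℕ) → CB F (F ↾ M) β t →
      (∃ λ k → ∃ λ r → t ≡ k ∷ r × CB (F ₍ k ₎) ((F ↾ M) ₍ k ₎) β (t /ₗ k))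
      ⊎ (∃ λ p → IsTp F p t × ∃ λ q → p ≡ suc q × M q))
    ×
    ((t : List ℕ) → CB F (F ↾ M) β t →
      (∃ λ k → M k × CB F (((F ↾ M) ₍ k ₎) ⊕ single k) β t)
      ⊎ (∃ λ p → IsTp F p t × All M t × ∃ λ q → p ≡ suc q × M q))
mainTheorem7 em α 2<α F (n , U) M _ β _ _ = split β , cover β
  where
  -- only positivity of α is needed: 0 < 2 < α
  0<α : oz <ₒ α
  0<α = ≤-trans (≤-suc ≤-zero) 2<α
  open Derivatives em α 0<α F n U M
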